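{- Let $n$ be an odd positive integer, $S=\{0,\dots,n-1\}$, and let $\alpha_1,\alpha_2,\alpha_3,\alpha_4\in\{1,\dots,n-1\}$. Define the $n\times n\times n\times n$ array $H$ by $H_{ijk\ell}\equiv\alpha_1 i+\alpha_2 j+\alpha_3 k+\alpha_4\ell\pmod n$, $i,j,k,\ell\in S$, $H_{ijk\ell}\in S$. Let $B=\alpha_1+\alpha_2+\alpha_3+\alpha_4$ and suppose that for all $m\in\{1,2,3,4\}$ and all $m'\in\{1,2,3,4\}$ with $m'\ne m$: $\gcd(\alpha_m,n)=1$; $\gcd(\alpha_m+\alpha_{m'},n)=1$; $\gcd(\alpha_m-\alpha_{m'},n)=1$; $\gcd(B-\alpha_m,n)=1$; $\gcd(B,n)=1$; $\gcd(B-2\alpha_m,n)=1$; $\gcd(B-\alpha_{m'}-2\alpha_m,n)=1$; $\gcd(B-2\alpha_{m'}-2\alpha_m,n)=1$. Then $H$ is a 4-D pandiagonal latin cube.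
   Context: An $n\times n$ array $(A_{xy})_{x,y\in S}$ with entries in $S$ is a pandiagonal latin square if for each $c\in S$ each of the index sets $\{(x,c)\}_x$, $\{(c,y)\}_y$, $\{(x,x+c\bmod n)\}_x$, $\{(x,c-x\bmod n)\}_x$ contains each element of $S$ exactly once among its entries. An $n\times n\times n$ array $(C_{xyz})$ with entries in $S$ is a pandiagonal latin cube if each of its $3n+6$ constituent squares is a pandiagonal latin square, where these squares are the $3n$ squares obtained by fixing one coordinate, and the six squares obtained by imposing, for one pair of coordinates $(a,b)$, either $x_a=x_b$ or $x_a+x_b=n-1$ (indexed by the remaining free coordinates). An $n\times n\times n\times n$ array $H$ with entries in $S$ is a 4-D pandiagonal latin cube if each of its $4n+12$ constituent 3-D cubes is a pandiagonal latin cube, where these are the $4n$ cubes obtained by fixing one of the four coordinates, and the $12$ cubes obtained by imposing, for one of the $6$ pairs of coordinates $(a,b)$, either $x_a=x_b$ or $x_a+x_b=n-1$ (indexed by the three remaining free coordinates, with $x_b$ determined by $x_a$). -}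

module Defs where

open import Data.Nat using (ℕ; _+_; _*_; _∸_; NonZero)
open import Data.Nat.DivMod using (_mod_)
open import Data.Fin using (Fin; toℕ; opposite)
open import Data.Product using (_×_; ∃!)
open import Relation.Binary.PropositionalEquality using (_≡_)

Square : ℕ → Set
Square n = Fin n → Fin n → Fin n

Cube : ℕ → Set
Cube n = Fin n → Fin n → Fin n → Fin n

Hyper : ℕ → Set
Hyper n = Fin n → Fin n → Fin n → Fin n → Fin n

module _ (n : ℕ) .{{_ : NonZero n}} where

  _+ₙ_ : Fin n → Fin n → Fin n
  x +ₙ c = (toℕ x + toℕ c) mod n

  _-ₙ_ : Fin n → Fin n → Fin n
  c -ₙ x = (toℕ c + (n ∸ toℕ x)) mod n

  ExactlyOnce : (Fin n → Fin n) → Set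
  ExactlyOnce f = ∀ (s : Fin n) → ∃! _≡_ (λ x → f x ≡ s)

  IsPandiagonalLatinSquare : Square n → Set
  IsPandiagonalLatinSquare A = ∀ (c : Fin n) →
      ExactlyOnce (λ x → A x c)
    × ExactlyOnce (λ y → A c y)
    × ExactlyOnce (λ x → A x (x +ₙ c))
    × ExactlyOnce (λ x → A x (c -ₙ x))

  -- opposite x = n - 1 - x, so x_b = opposite x_a encodes x_a + x_b = n - 1
  IsPandiagonalLatinCube : Cube n → Set
  IsPandiagonalLatinCube C =
      (∀ (c : Fin n) →
          IsPandiagonalLatinSquare (λ y z → C c y z)
        × IsPandiagonalLatinSquare (λ x z → C x c z)
        × IsPandiagonalLatinSquare (λ x y → C x y c))
    × IsPandiagonalLatinSquare (λ x z → C x x z)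
    × IsPandiagonalLatinSquare (λ x z → C x (opposite x) z)
    × IsPandiagonalLatinSquare (λ x y → C x y x)
    × IsPandiagonalLatinSquare (λ x y → C x y (opposite x))
    × IsPandiagonalLatinSquare (λ x y → C x y y)
    × IsPandiagonalLatinSquare (λ x y → C x y (opposite y))

  Is4DPandiagonalLatinCube : Hyper n → Set
  Is4DPandiagonalLatinCube H =
      (∀ (c : Fin n) →
          IsPandiagonalLatinCube (λ j k l → H c j k l)
        × IsPandiagonalLatinCube (λ i k l → H i c k l)
        × IsPandiagonalLatinCube (λ i j l → H i j c l)
        × IsPandiagonalLatinCube (λ i j k → H i j k c))
    × IsPandiagonalLatinCube (λ i k l → H i i k l)
    × IsPandiagonalLatinCube (λ i k l → H i (opposite i) k l)
    × IsPandiagonalLatinCube (λ i j l → H i j i l)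
    × IsPandiagonalLatinCube (λ i j l → H i j (opposite i) l)
    × IsPandiagonalLatinCube (λ i j k → H i j k i)
    × IsPandiagonalLatinCube (λ i j k → H i j k (opposite i))
    × IsPandiagonalLatinCube (λ i j l → H i j j l)
    × IsPandiagonalLatinCube (λ i j l → H i j (opposite j) l)
    × IsPandiagonalLatinCube (λ i j k → H i j k j)
    × IsPandiagonalLatinCube (λ i j k → H i j k (opposite j))
    × IsPandiagonalLatinCube (λ i j k → H i j k k)
    × IsPandiagonalLatinCube (λ i j k → H i j k (opposite k))

  linearArray : ℕ → ℕ → ℕ → ℕ → Hyper n
  linearArray a₁ a₂ a₃ a₄ i j k l =
    (a₁ * toℕ i + a₂ * toℕ j + a₃ * toℕ k + a₄ * toℕ l) mod n

-- Every constituent square of H is affine modulo n: along each of its rows, columns,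
-- diagonals and antidiagonals the entry is c·x + r (mod n), where the slope c is a
-- combination ε₁α₁ + ε₂α₂ + ε₃α₃ + ε₄α₄ with εₘ ∈ {-1, 0, 1}, not all zero (an antidiagonal
-- condition x_b = n - 1 - x_a contributes a minus sign).  An affine map of ℤ/n with unit
-- slope is a bijection.  Up to sign, the 80 nonzero sign combinations of four numbers are
-- exactly the 40 forms whose gcd with n is assumed to be 1; this is checked by computation.

module Submission where

open import Defs
open import Data.Nat using (ℕ; NonZero; _≤_; _<_; _%_)
open import Data.Fin using (Fin; zero; suc)
open import Data.Integer using (ℤ; +_; _+_; _-_; _*_)
open import Data.Integer.GCD using (gcd)
open import Relation.Binary.PropositionalEquality using (_≡_; _≢_)

import Data.Nat as ℕ
import Data.Nat.Properties as ℕ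
import Data.Nat.Coprimality as ℕ using (Coprime; gcd≡1⇒coprime)
import Data.Nat.Divisibility as ℕ using (_∣_)
open import Data.Nat.Divisibility using (>⇒∤)
open import Data.Nat.DivMod using (_mod_; _/_; m≡m%n+[m/n]*n)
open import Data.Fin using (toℕ; opposite; punchOut)
open import Data.Fin.Properties
  using (toℕ<n; toℕ-injective; toℕ-fromℕ<; opposite-prop; punchOut-injective; injective⇒≤)
  renaming (any? to anyFin?; _≟_ to _≟ᶠ_)
open import Data.Integer using (-_; 0ℤ; 1ℤ; ∣_∣; -[1+_]) renaming (_≟_ to _≟ℤ_)
open import Data.Integer.Properties
  using ( pos-+; pos-*; +-assoc; +-identityˡ; +-identityʳ; *-identityˡ; *-zeroʳ; +-inverseʳ
        ; m-n≡m⊖n; ⊖-≥; ∣m⊝n∣≤m⊔n; ∣-i∣≡∣i∣; ∣i∣≡0⇒i≡0; i-j≡0⇒i≡j; +-injective)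
open import Data.Integer.Divisibility.Signed
  using (_∣_; divides; ∣m⇒∣-m; ∣m∣n⇒∣m+n; ∣n⇒∣m*n; ∣⇒∣ᵤ; ∣ᵤ⇒∣)
open import Data.Integer.Coprimality using (Coprime; coprime-divisor)
import Data.Integer.Coprimality as Coprime using (sym)
open import Data.Integer.Tactic.RingSolver using (solve-∀)
open import Data.Bool using (Bool; true; false; T)
open import Data.Unit using (⊤)
open import Data.Product using (∃; ∃₂; _×_; _,_)
open import Data.Sum using (_⊎_; inj₁; inj₂)
open import Data.Vec using (Vec; []; _∷_; replicate; zipWith; map)
open import Data.Vec.Properties using (≡-dec)
open import Data.List using (List; []; _∷_; cartesianProductWith)
open import Data.List.Membership.Propositional using (_∈_)
open import Data.List.Membership.Propositional.Properties using (∈-cartesianProductWith⁺)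
open import Data.List.Relation.Unary.Any using (here; there)
open import Data.List.Relation.Unary.All as All using (All; all?)
open import Function using (_∘_)
open import Function.Definitions using (Injective)
open import Relation.Binary.PropositionalEquality
  using (refl; sym; trans; cong; cong₂; subst; module ≡-Reasoning)
open import Relation.Binary.Bundles using (Setoid)
import Relation.Binary.Reasoning.Setoid as SetoidReasoning
open import Relation.Nullary using (yes; no; contradiction)
open import Relation.Nullary.Decidable
  using (Dec; False; ¬?; _×-dec_; _⊎-dec_; _→-dec_; toWitness; toWitnessFalse)

injective⇒surjective : ∀ {m} {f : Fin m → Fin m} → Injective _≡_ _≡_ f → ∀ s → ∃ λ x → f x ≡ s
injective⇒surjective {ℕ.zero} _ ()
injective⇒surjective {ℕ.suc m} {f} f-inj s with anyFin? (λ x → f x ≟ᶠ s)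
... | yes hit = hit
... | no miss = contradiction (injective⇒≤ g-inj) (ℕ.<-irrefl refl)
  where
  f≢s : ∀ x → s ≢ f x
  f≢s x s≡fx = miss (x , sym s≡fx)
  g : Fin (ℕ.suc m) → Fin m
  g x = punchOut (f≢s x)
  g-inj : Injective _≡_ _≡_ g
  g-inj {x} {y} gx≡gy = f-inj (punchOut-injective (f≢s x) (f≢s y) gx≡gy)

pos-∸ : ∀ {m k} → k ≤ m → + (m ℕ.∸ k) ≡ + m - + k
pos-∸ {m} {k} k≤m = trans (sym (⊖-≥ k≤m)) (sym (m-n≡m⊖n m k))

infixl 6 _⊕_ _⊖_
infixr 7 _⊛_

data LinExpr (k : ℕ) : Set where
  var     : Fin k → LinExpr k
  _⊕_ _⊖_ : LinExpr k → LinExpr k → LinExpr k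
  _⊛_     : ℤ → LinExpr k → LinExpr k

⟦_⟧ : ∀ {k} → LinExpr k → (Fin k → ℤ) → ℤ
⟦ var m ⟧ a = a m
⟦ e ⊕ f ⟧ a = ⟦ e ⟧ a + ⟦ f ⟧ a
⟦ e ⊖ f ⟧ a = ⟦ e ⟧ a - ⟦ f ⟧ a
⟦ c ⊛ e ⟧ a = c * ⟦ e ⟧ a

basis : ∀ {k} → Fin k → Vec ℤ k
basis {ℕ.suc k} zero = 1ℤ ∷ replicate k 0ℤ
basis (suc m)        = 0ℤ ∷ basis m

coefficients : ∀ {k} → LinExpr k → Vec ℤ k
coefficients (var m) = basis m
coefficients (e ⊕ f) = zipWith _+_ (coefficients e) (coefficients f)
coefficients (e ⊖ f) = zipWith _-_ (coefficients e) (coefficients f)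
coefficients (c ⊛ e) = map (c *_) (coefficients e)

infix 8 _·_
_·_ : ∀ {k} → Vec ℤ k → (Fin k → ℤ) → ℤ
[]      · a = 0ℤ
(x ∷ u) · a = x * a zero + u · (a ∘ suc)

replicate-0-· : ∀ k a → replicate k 0ℤ · a ≡ 0ℤ
replicate-0-· ℕ.zero    a = refl
replicate-0-· (ℕ.suc k) a = trans (+-identityˡ _) (replicate-0-· k (a ∘ suc))

basis-· : ∀ {k} (m : Fin k) a → basis m · a ≡ a m
basis-· {ℕ.suc k} zero a =
  trans (cong (_+_ (1ℤ * a zero)) (replicate-0-· k (a ∘ suc))) (trans (+-identityʳ _) (*-identityˡ _))
basis-· (suc m) a = trans (+-identityˡ _) (basis-· m (a ∘ suc))

zipWith-+-· : ∀ {k} (u v : Vec ℤ k) a → zipWith _+_ u v · a ≡ u · a + v · a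
zipWith-+-· []      []      a = refl
zipWith-+-· (x ∷ u) (y ∷ v) a =
  trans (cong (_+_ ((x + y) * a zero)) (zipWith-+-· u v (a ∘ suc))) (interchange x y (a zero) _ _)
  where
  interchange : ∀ x y a s t → (x + y) * a + (s + t) ≡ (x * a + s) + (y * a + t)
  interchange = solve-∀

zipWith---· : ∀ {k} (u v : Vec ℤ k) a → zipWith _-_ u v · a ≡ u · a - v · a
zipWith---· []      []      a = refl
zipWith---· (x ∷ u) (y ∷ v) a =
  trans (cong (_+_ ((x - y) * a zero)) (zipWith---· u v (a ∘ suc))) (interchange x y (a zero) _ _)
  where
  interchange : ∀ x y a s t → (x - y) * a + (s - t) ≡ (x * a + s) - (y * a + t)
  interchange = solve-∀

map-*-· : ∀ {k} c (u : Vec ℤ k) a → map (c *_) u · a ≡ c * u · a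
map-*-· c []      a = sym (*-zeroʳ c)
map-*-· c (x ∷ u) a =
  trans (cong (_+_ (c * x * a zero)) (map-*-· c u (a ∘ suc))) (distrib c x (a zero) _)
  where
  distrib : ∀ c x a s → c * x * a + c * s ≡ c * (x * a + s)
  distrib = solve-∀

map-neg-· : ∀ {k} (u : Vec ℤ k) a → map -_ u · a ≡ - (u · a)
map-neg-· []      a = refl
map-neg-· (x ∷ u) a = trans (cong (_+_ (- x * a zero)) (map-neg-· u (a ∘ suc))) (distrib x (a zero) _)
  where
  distrib : ∀ x a s → - x * a + - s ≡ - (x * a + s)
  distrib = solve-∀

⟦⟧≡coefficients-· : ∀ {k} (e : LinExpr k) a → ⟦ e ⟧ a ≡ coefficients e · a
⟦⟧≡coefficients-· (var m) a = sym (basis-· m a)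
⟦⟧≡coefficients-· (e ⊕ f) a =
  trans (cong₂ _+_ (⟦⟧≡coefficients-· e a) (⟦⟧≡coefficients-· f a)) (sym (zipWith-+-· (coefficients e) (coefficients f) a))
⟦⟧≡coefficients-· (e ⊖ f) a =
  trans (cong₂ _-_ (⟦⟧≡coefficients-· e a) (⟦⟧≡coefficients-· f a)) (sym (zipWith---· (coefficients e) (coefficients f) a))
⟦⟧≡coefficients-· (c ⊛ e) a = trans (cong (c *_) (⟦⟧≡coefficients-· e a)) (sym (map-*-· c (coefficients e) a))

OnSquareLines : ∀ {k} → (LinExpr k → Set) → LinExpr k → LinExpr k → Set
OnSquareLines P u v = P u × P v × P (u ⊕ v) × P (u ⊖ v)

OnCubeLines : ∀ {k} → (LinExpr k → Set) → LinExpr k → LinExpr k → LinExpr k → Set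
OnCubeLines P u v w =
    OnSquareLines P v w       × OnSquareLines P u w       × OnSquareLines P u v
  × OnSquareLines P (u ⊕ v) w × OnSquareLines P (u ⊖ v) w
  × OnSquareLines P (u ⊕ w) v × OnSquareLines P (u ⊖ w) v
  × OnSquareLines P u (v ⊕ w) × OnSquareLines P u (v ⊖ w)

OnHyperLines : ∀ {k} → (LinExpr k → Set) → LinExpr k → LinExpr k → LinExpr k → LinExpr k → Set
OnHyperLines P u v w t =
    OnCubeLines P v w t × OnCubeLines P u w t × OnCubeLines P u v t × OnCubeLines P u v w
  × OnCubeLines P (u ⊕ v) w t × OnCubeLines P (u ⊖ v) w t
  × OnCubeLines P (u ⊕ w) v t × OnCubeLines P (u ⊖ w) v t
  × OnCubeLines P (u ⊕ t) v w × OnCubeLines P (u ⊖ t) v w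
  × OnCubeLines P u (v ⊕ w) t × OnCubeLines P u (v ⊖ w) t
  × OnCubeLines P u (v ⊕ t) w × OnCubeLines P u (v ⊖ t) w
  × OnCubeLines P u v (w ⊕ t) × OnCubeLines P u v (w ⊖ t)

infix 4 _≡±_ _≡±?_
_≡±_ : ∀ {k} → Vec ℤ k → Vec ℤ k → Set
u ≡± v = u ≡ v ⊎ u ≡ map -_ v

_≡±?_ : ∀ {k} (u v : Vec ℤ k) → Dec (u ≡± v)
u ≡±? v = ≡-dec _≟ℤ_ u v ⊎-dec ≡-dec _≟ℤ_ u (map -_ v)

signs : List ℤ
signs = - 1ℤ ∷ 0ℤ ∷ 1ℤ ∷ []

signVectors : ∀ k → List (Vec ℤ k)
signVectors ℕ.zero    = [] ∷ []
signVectors (ℕ.suc k) = cartesianProductWith _∷_ signs (signVectors k)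

isSign : ℤ → Bool
isSign (+ 0)    = true
isSign (+ 1)    = true
isSign -[1+ 0 ] = true
isSign _        = false

isSign⇒∈signs : ∀ x → T (isSign x) → x ∈ signs
isSign⇒∈signs -[1+ 0 ] _ = here refl
isSign⇒∈signs (+ 0)    _ = there (here refl)
isSign⇒∈signs (+ 1)    _ = there (there (here refl))

-- Boolean entrywise, so that on a closed vector it reduces to ⊤ and is discharged by `_`.
IsSignVector : ∀ {k} → Vec ℤ k → Set
IsSignVector []      = ⊤
IsSignVector (x ∷ u) = T (isSign x) × IsSignVector u

signVector⇒∈signVectors : ∀ {k} {u : Vec ℤ k} → IsSignVector u → u ∈ signVectors k
signVector⇒∈signVectors {u = []}    _          = here refl
signVector⇒∈signVectors {u = x ∷ u} (x± , u±) =
  ∈-cartesianProductWith⁺ _∷_ (isSign⇒∈signs x x±) (signVector⇒∈signVectors u±)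

record IsSignCombination {k} (e : LinExpr k) : Set where
  field
    signVector : IsSignVector (coefficients e)
    nonzero    : False (≡-dec _≟ℤ_ (coefficients e) (replicate _ 0ℤ))

-- ⟦ total ⟧ a is the B of the statement, and ⟦ f ⟧ a for each form f of CoveredByHypotheses
-- is verbatim the expression in the corresponding gcd hypothesis.
total : LinExpr 4
total = var zero ⊕ var (suc zero) ⊕ var (suc (suc zero)) ⊕ var (suc (suc (suc zero)))

CoveredByHypotheses : Vec ℤ 4 → Set
CoveredByHypotheses u =
    (∃ λ m → u ≡± coefficients (var m))
  ⊎ (∃ λ m → u ≡± coefficients (total ⊖ var m))
  ⊎ u ≡± coefficients total
  ⊎ (∃ λ m → u ≡± coefficients (total ⊖ + 2 ⊛ var m))
  ⊎ (∃₂ λ m m' → m' ≢ m × u ≡± coefficients (var m ⊕ var m'))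
  ⊎ (∃₂ λ m m' → m' ≢ m × u ≡± coefficients (var m ⊖ var m'))
  ⊎ (∃₂ λ m m' → m' ≢ m × u ≡± coefficients (total ⊖ var m' ⊖ + 2 ⊛ var m))
  ⊎ (∃₂ λ m m' → m' ≢ m × u ≡± coefficients (total ⊖ + 2 ⊛ var m' ⊖ + 2 ⊛ var m))

coveredByHypotheses? : ∀ u → Dec (CoveredByHypotheses u)
coveredByHypotheses? u =
        anyFin? (λ m → u ≡±? coefficients (var m))
  ⊎-dec anyFin? (λ m → u ≡±? coefficients (total ⊖ var m))
  ⊎-dec u ≡±? coefficients total
  ⊎-dec anyFin? (λ m → u ≡±? coefficients (total ⊖ + 2 ⊛ var m))
  ⊎-dec pairs? (λ m m' → var m ⊕ var m')
  ⊎-dec pairs? (λ m m' → var m ⊖ var m')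
  ⊎-dec pairs? (λ m m' → total ⊖ var m' ⊖ + 2 ⊛ var m)
  ⊎-dec pairs? (λ m m' → total ⊖ + 2 ⊛ var m' ⊖ + 2 ⊛ var m)
  where
  pairs? : (f : Fin 4 → Fin 4 → LinExpr 4) → Dec (∃₂ λ m m' → m' ≢ m × u ≡± coefficients (f m m'))
  pairs? f = anyFin? λ m → anyFin? λ m' → ¬? (m' ≟ᶠ m) ×-dec u ≡±? coefficients (f m m')

nonzeroSignVectorsCovered : All (λ u → u ≢ replicate 4 0ℤ → CoveredByHypotheses u) (signVectors 4)
nonzeroSignVectorsCovered =
  toWitness {a? = all? (λ u → ¬? (≡-dec _≟ℤ_ u (replicate 4 0ℤ)) →-dec coveredByHypotheses? u) (signVectors 4)} _

signCombination⇒covered : ∀ {e} → IsSignCombination e → CoveredByHypotheses (coefficients e)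
signCombination⇒covered e± =
  All.lookup nonzeroSignVectorsCovered (signVector⇒∈signVectors signVector) (toWitnessFalse nonzero)
  where open IsSignCombination e±

module _ (n : ℕ) .{{_ : NonZero n}} where

  private
    N : ℤ
    N = + n

  -- A record rather than a synonym for N ∣ x - y, so that x and y can be inferred.
  infix 4 _≈_
  record _≈_ (x y : ℤ) : Set where
    constructor mk≈
    field divides-difference : N ∣ x - y

  ≈-refl : ∀ {x} → x ≈ x
  ≈-refl {x} = mk≈ (divides 0ℤ (+-inverseʳ x))

  ≈-reflexive : ∀ {x y} → x ≡ y → x ≈ y
  ≈-reflexive refl = ≈-refl

  ≈-≡-trans : ∀ {x y z} → x ≈ y → y ≡ z → x ≈ z
  ≈-≡-trans x≈y refl = x≈y

  ≈-sym : ∀ {x y} → x ≈ y → y ≈ x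
  ≈-sym {x} {y} (mk≈ x≈y) = mk≈ (subst (N ∣_) (swap x y) (∣m⇒∣-m x≈y))
    where
    swap : ∀ x y → - (x - y) ≡ y - x
    swap = solve-∀

  ≈-trans : ∀ {x y z} → x ≈ y → y ≈ z → x ≈ z
  ≈-trans {x} {y} {z} (mk≈ x≈y) (mk≈ y≈z) = mk≈ (subst (N ∣_) (telescope x y z) (∣m∣n⇒∣m+n x≈y y≈z))
    where
    telescope : ∀ x y z → (x - y) + (y - z) ≡ x - z
    telescope = solve-∀

  ≈-setoid : Setoid _ _
  ≈-setoid = record
    { Carrier = ℤ ; _≈_ = _≈_
    ; isEquivalence = record { refl = ≈-refl ; sym = ≈-sym ; trans = ≈-trans } }

  +-cong-≈ : ∀ {x y u v} → x ≈ y → u ≈ v → x + u ≈ y + v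
  +-cong-≈ {x} {y} {u} {v} (mk≈ x≈y) (mk≈ u≈v) = mk≈ (subst (N ∣_) (regroup x y u v) (∣m∣n⇒∣m+n x≈y u≈v))
    where
    regroup : ∀ x y u v → (x - y) + (u - v) ≡ (x + u) - (y + v)
    regroup = solve-∀

  +-congˡ-≈ : ∀ x {u v} → u ≈ v → x + u ≈ x + v
  +-congˡ-≈ x = +-cong-≈ (≈-refl {x})

  +-congʳ-≈ : ∀ r {x y} → x ≈ y → x + r ≈ y + r
  +-congʳ-≈ r x≈y = +-cong-≈ x≈y (≈-refl {r})

  *-congˡ-≈ : ∀ c {x y} → x ≈ y → c * x ≈ c * y
  *-congˡ-≈ c {x} {y} (mk≈ x≈y) = mk≈ (subst (N ∣_) (distrib c x y) (∣n⇒∣m*n c x≈y))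
    where
    distrib : ∀ c x y → c * (x - y) ≡ c * x - c * y
    distrib = solve-∀

  +-cancelʳ-≈ : ∀ r {x y} → x + r ≈ y + r → x ≈ y
  +-cancelʳ-≈ r {x} {y} (mk≈ d) = mk≈ (subst (N ∣_) (cancel x y r) d)
    where
    cancel : ∀ x y r → (x + r) - (y + r) ≡ x - y
    cancel = solve-∀

  *-cancelˡ-≈ : ∀ c {x y} → Coprime c N → c * x ≈ c * y → x ≈ y
  *-cancelˡ-≈ c {x} {y} c⊥N (mk≈ cx≈cy) =
    mk≈ (∣ᵤ⇒∣ (coprime-divisor N c (x - y) (Coprime.sym {c} {N} c⊥N) (∣⇒∣ᵤ (subst (N ∣_) (factor c x y) cx≈cy))))
    where
    factor : ∀ c x y → c * x - c * y ≡ c * (x - y)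
    factor = solve-∀

  gcd≡1⇒coprime : ∀ x → gcd x N ≡ + 1 → Coprime x N
  gcd≡1⇒coprime _ g = ℕ.gcd≡1⇒coprime (+-injective g)

  coprime-neg : ∀ x → Coprime x N → Coprime (- x) N
  coprime-neg x = subst (λ m → ℕ.Coprime m n) (sym (∣-i∣≡∣i∣ x))

  toℤ : Fin n → ℤ
  toℤ x = + toℕ x

  toℤ-mod : ∀ m → toℤ (m mod n) ≈ + m
  toℤ-mod m = ≈-sym (mk≈ (divides (+ q) (begin
      + m - + r                ≡⟨ cong (λ k → + k - + r) m≡r+q*n ⟩
      + (r ℕ.+ q ℕ.* n) - + r  ≡⟨ cong (_- + r) (trans (pos-+ r (q ℕ.* n)) (cong (_+_ (+ r)) (pos-* q n))) ⟩
      + r + + q * N - + r      ≡⟨ cancel (+ r) (+ q) N ⟩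
      + q * N                  ∎)))
    where
    open ≡-Reasoning
    q r : ℕ
    q = m / n
    r = toℕ (m mod n)
    m≡r+q*n : m ≡ r ℕ.+ q ℕ.* n
    m≡r+q*n = trans (m≡m%n+[m/n]*n m n) (cong (ℕ._+ q ℕ.* n) (sym (toℕ-fromℕ< _)))
    cancel : ∀ r q N → r + q * N - r ≡ q * N
    cancel = solve-∀

  toℤ-+ₙ : ∀ x c → toℤ (_+ₙ_ n x c) ≈ toℤ x + toℤ c
  toℤ-+ₙ x c = ≈-trans (toℤ-mod _) (≈-reflexive (pos-+ (toℕ x) (toℕ c)))

  toℤ--ₙ : ∀ c x → toℤ (_-ₙ_ n c x) ≈ toℤ c - toℤ x
  toℤ--ₙ c x = ≈-trans (toℤ-mod _)
    (≈-trans (≈-reflexive (trans (pos-+ (toℕ c) _) (cong (_+_ (toℤ c)) (pos-∸ (ℕ.<⇒≤ (toℕ<n x))))))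
             (mk≈ (divides 1ℤ (drop-N (toℤ c) (toℤ x) N))))
    where
    drop-N : ∀ c x N → c + (N - x) - (c - x) ≡ 1ℤ * N
    drop-N = solve-∀

  toℤ-opposite : ∀ x → toℤ (opposite x) ≡ N - 1ℤ - toℤ x
  toℤ-opposite x = trans (cong +_ (opposite-prop x)) (trans (pos-∸ (toℕ<n x)) (regroup N (toℤ x)))
    where
    regroup : ∀ N x → N - (1ℤ + x) ≡ N - 1ℤ - x
    regroup = solve-∀

  toℤ-injective : ∀ {x y} → toℤ x ≈ toℤ y → x ≡ y
  toℤ-injective {x} {y} (mk≈ N∣x-y) =
    toℕ-injective (+-injective (i-j≡0⇒i≡j _ _ (∣i∣≡0⇒i≡0 (below-n⇒0 (∣⇒∣ᵤ N∣x-y) ∣x-y∣<n))))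
    where
    below-n⇒0 : ∀ {m} → n ℕ.∣ m → m < n → m ≡ 0
    below-n⇒0 {ℕ.zero}  _   _   = refl
    below-n⇒0 {ℕ.suc m} n∣m m<n = contradiction n∣m (>⇒∤ m<n)
    ∣x-y∣<n : ∣ toℤ x - toℤ y ∣ < n
    ∣x-y∣<n = subst (_< n) (cong ∣_∣ (sym (m-n≡m⊖n (toℕ x) (toℕ y))))
                (ℕ.≤-<-trans (∣m⊝n∣≤m⊔n (toℕ x) (toℕ y)) (ℕ.⊔-pres-<m (toℕ<n x) (toℕ<n y)))

  affine⇒exactlyOnce : ∀ {f : Fin n → Fin n} c {r} → Coprime c N →
                       (∀ x → toℤ (f x) ≈ c * toℤ x + r) → ExactlyOnce n f
  affine⇒exactlyOnce {f} c {r} c⊥N f≈ s =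
    let x , fx≡s = injective⇒surjective f-injective s
    in  x , fx≡s , λ fy≡s → f-injective (trans fx≡s (sym fy≡s))
    where
    open SetoidReasoning ≈-setoid
    f-injective : Injective _≡_ _≡_ f
    f-injective {x} {y} fx≡fy = toℤ-injective (*-cancelˡ-≈ c c⊥N (+-cancelʳ-≈ r (begin
      c * toℤ x + r  ≈⟨ f≈ x ⟨
      toℤ (f x)      ≡⟨ cong toℤ fx≡fy ⟩
      toℤ (f y)      ≈⟨ f≈ y ⟩
      c * toℤ y + r  ∎)))

  record IsAffineSquare (A : Square n) (p q : ℤ) : Set where
    constructor mkAffine
    field
      offset  : ℤ
      entries : ∀ x y → toℤ (A x y) ≈ p * toℤ x + q * toℤ y + offset

  affine⇒pandiagonalSquare : ∀ {A p q} →
    Coprime p N → Coprime q N → Coprime (p + q) N → Coprime (p - q) N →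
    IsAffineSquare A p q → IsPandiagonalLatinSquare n A
  affine⇒pandiagonalSquare {A} {p} {q} p⊥N q⊥N p+q⊥N p-q⊥N (mkAffine r A≈) c =
      affine⇒exactlyOnce p p⊥N row
    , affine⇒exactlyOnce q q⊥N column
    , affine⇒exactlyOnce (p + q) p+q⊥N diagonal
    , affine⇒exactlyOnce (p - q) p-q⊥N antidiagonal
    where
    open SetoidReasoning ≈-setoid
    C : ℤ
    C = toℤ c
    row : ∀ x → toℤ (A x c) ≈ p * toℤ x + (q * C + r)
    row x = ≈-≡-trans (A≈ x c) (+-assoc (p * toℤ x) (q * C) r)
    column : ∀ y → toℤ (A c y) ≈ q * toℤ y + (p * C + r)
    column y = ≈-≡-trans (A≈ c y) (exchange p C q (toℤ y) r)
      where
      exchange : ∀ p C q Y r → p * C + q * Y + r ≡ q * Y + (p * C + r)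
      exchange = solve-∀
    diagonal : ∀ x → toℤ (A x (_+ₙ_ n x c)) ≈ (p + q) * toℤ x + (q * C + r)
    diagonal x = begin
      toℤ (A x (_+ₙ_ n x c))            ≈⟨ A≈ x _ ⟩
      p * X + q * toℤ (_+ₙ_ n x c) + r  ≈⟨ +-congʳ-≈ r (+-congˡ-≈ (p * X) (*-congˡ-≈ q (toℤ-+ₙ x c))) ⟩
      p * X + q * (X + C) + r           ≡⟨ merge p q X C r ⟩
      (p + q) * X + (q * C + r)         ∎
      where
      X : ℤ
      X = toℤ x
      merge : ∀ p q X C r → p * X + q * (X + C) + r ≡ (p + q) * X + (q * C + r)
      merge = solve-∀
    antidiagonal : ∀ x → toℤ (A x (_-ₙ_ n c x)) ≈ (p - q) * toℤ x + (q * C + r)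
    antidiagonal x = begin
      toℤ (A x (_-ₙ_ n c x))            ≈⟨ A≈ x _ ⟩
      p * X + q * toℤ (_-ₙ_ n c x) + r  ≈⟨ +-congʳ-≈ r (+-congˡ-≈ (p * X) (*-congˡ-≈ q (toℤ--ₙ c x))) ⟩
      p * X + q * (C - X) + r           ≡⟨ merge p q X C r ⟩
      (p - q) * X + (q * C + r)         ∎
      where
      X : ℤ
      X = toℤ x
      merge : ∀ p q X C r → p * X + q * (C - X) + r ≡ (p - q) * X + (q * C + r)
      merge = solve-∀

  record IsAffineCube (C : Cube n) (p q r : ℤ) : Set where
    constructor mkAffine
    field
      offset  : ℤ
      entries : ∀ x y z → toℤ (C x y z) ≈ p * toℤ x + q * toℤ y + r * toℤ z + offset

  module _ {C : Cube n} {p q r : ℤ} (C-affine : IsAffineCube C p q r) where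
    open IsAffineCube C-affine

    affineCube-slice₁ : ∀ c → IsAffineSquare (λ y z → C c y z) q r
    affineCube-slice₁ c = mkAffine (p * toℤ c + offset) λ y z →
      ≈-≡-trans (entries c y z) (move p q r (toℤ c) (toℤ y) (toℤ z) offset)
      where
      move : ∀ p q r c y z s → p * c + q * y + r * z + s ≡ q * y + r * z + (p * c + s)
      move = solve-∀

    affineCube-slice₂ : ∀ c → IsAffineSquare (λ x z → C x c z) p r
    affineCube-slice₂ c = mkAffine (q * toℤ c + offset) λ x z →
      ≈-≡-trans (entries x c z) (move p q r (toℤ x) (toℤ c) (toℤ z) offset)
      where
      move : ∀ p q r x c z s → p * x + q * c + r * z + s ≡ p * x + r * z + (q * c + s)
      move = solve-∀

    affineCube-slice₃ : ∀ c → IsAffineSquare (λ x y → C x y c) p q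
    affineCube-slice₃ c = mkAffine (r * toℤ c + offset) λ x y →
      ≈-≡-trans (entries x y c) (move p q r (toℤ x) (toℤ y) (toℤ c) offset)
      where
      move : ∀ p q r x y c s → p * x + q * y + r * c + s ≡ p * x + q * y + (r * c + s)
      move = solve-∀

    affineCube-diagonal₁₂ : IsAffineSquare (λ x z → C x x z) (p + q) r
    affineCube-diagonal₁₂ = mkAffine offset λ x z →
      ≈-≡-trans (entries x x z) (merge p q r (toℤ x) (toℤ z) offset)
      where
      merge : ∀ p q r x z s → p * x + q * x + r * z + s ≡ (p + q) * x + r * z + s
      merge = solve-∀

    affineCube-diagonal₁₃ : IsAffineSquare (λ x y → C x y x) (p + r) q
    affineCube-diagonal₁₃ = mkAffine offset λ x y →
      ≈-≡-trans (entries x y x) (merge p q r (toℤ x) (toℤ y) offset)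
      where
      merge : ∀ p q r x y s → p * x + q * y + r * x + s ≡ (p + r) * x + q * y + s
      merge = solve-∀

    affineCube-diagonal₂₃ : IsAffineSquare (λ x y → C x y y) p (q + r)
    affineCube-diagonal₂₃ = mkAffine offset λ x y →
      ≈-≡-trans (entries x y y) (merge p q r (toℤ x) (toℤ y) offset)
      where
      merge : ∀ p q r x y s → p * x + q * y + r * y + s ≡ p * x + (q + r) * y + s
      merge = solve-∀

    affineCube-reflect₂ : IsAffineCube (λ x y z → C x (opposite y) z) p (- q) r
    affineCube-reflect₂ = mkAffine (offset + q * (N - 1ℤ)) λ x y z →
      ≈-≡-trans (entries x (opposite y) z) (reflect (toℤ-opposite y))
      where
      reflect : ∀ {x y z o} → o ≡ N - 1ℤ - y → p * x + q * o + r * z + offset ≡ p * x + - q * y + r * z + (offset + q * (N - 1ℤ))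
      reflect {x} {y} {z} refl = ring p q r x y z offset N
        where
        ring : ∀ p q r x y z s N → p * x + q * (N - 1ℤ - y) + r * z + s ≡ p * x + - q * y + r * z + (s + q * (N - 1ℤ))
        ring = solve-∀

    affineCube-reflect₃ : IsAffineCube (λ x y z → C x y (opposite z)) p q (- r)
    affineCube-reflect₃ = mkAffine (offset + r * (N - 1ℤ)) λ x y z →
      ≈-≡-trans (entries x y (opposite z)) (reflect (toℤ-opposite z))
      where
      reflect : ∀ {x y z o} → o ≡ N - 1ℤ - z → p * x + q * y + r * o + offset ≡ p * x + q * y + - r * z + (offset + r * (N - 1ℤ))
      reflect {x} {y} {z} refl = ring p q r x y z offset N
        where
        ring : ∀ p q r x y z s N → p * x + q * y + r * (N - 1ℤ - z) + s ≡ p * x + q * y + - r * z + (s + r * (N - 1ℤ))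
        ring = solve-∀

  record IsAffineHyper (H : Hyper n) (p₁ p₂ p₃ p₄ : ℤ) : Set where
    constructor mkAffine
    field
      offset  : ℤ
      entries : ∀ i j k l →
        toℤ (H i j k l) ≈ p₁ * toℤ i + p₂ * toℤ j + p₃ * toℤ k + p₄ * toℤ l + offset

  module _ {H : Hyper n} {p₁ p₂ p₃ p₄ : ℤ} (H-affine : IsAffineHyper H p₁ p₂ p₃ p₄) where
    open IsAffineHyper H-affine

    affineHyper-slice₁ : ∀ c → IsAffineCube (λ j k l → H c j k l) p₂ p₃ p₄
    affineHyper-slice₁ c = mkAffine (p₁ * toℤ c + offset) λ x y z →
      ≈-≡-trans (entries c x y z) (move p₁ p₂ p₃ p₄ (toℤ c) (toℤ x) (toℤ y) (toℤ z) offset)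
      where
      move : ∀ p₁ p₂ p₃ p₄ c x y z s →
        p₁ * c + p₂ * x + p₃ * y + p₄ * z + s ≡ p₂ * x + p₃ * y + p₄ * z + (p₁ * c + s)
      move = solve-∀

    affineHyper-slice₂ : ∀ c → IsAffineCube (λ i k l → H i c k l) p₁ p₃ p₄
    affineHyper-slice₂ c = mkAffine (p₂ * toℤ c + offset) λ x y z →
      ≈-≡-trans (entries x c y z) (move p₁ p₂ p₃ p₄ (toℤ c) (toℤ x) (toℤ y) (toℤ z) offset)
      where
      move : ∀ p₁ p₂ p₃ p₄ c x y z s →
        p₁ * x + p₂ * c + p₃ * y + p₄ * z + s ≡ p₁ * x + p₃ * y + p₄ * z + (p₂ * c + s)
      move = solve-∀

    affineHyper-slice₃ : ∀ c → IsAffineCube (λ i j l → H i j c l) p₁ p₂ p₄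
    affineHyper-slice₃ c = mkAffine (p₃ * toℤ c + offset) λ x y z →
      ≈-≡-trans (entries x y c z) (move p₁ p₂ p₃ p₄ (toℤ c) (toℤ x) (toℤ y) (toℤ z) offset)
      where
      move : ∀ p₁ p₂ p₃ p₄ c x y z s →
        p₁ * x + p₂ * y + p₃ * c + p₄ * z + s ≡ p₁ * x + p₂ * y + p₄ * z + (p₃ * c + s)
      move = solve-∀

    affineHyper-slice₄ : ∀ c → IsAffineCube (λ i j k → H i j k c) p₁ p₂ p₃
    affineHyper-slice₄ c = mkAffine (p₄ * toℤ c + offset) λ x y z →
      ≈-≡-trans (entries x y z c) (move p₁ p₂ p₃ p₄ (toℤ c) (toℤ x) (toℤ y) (toℤ z) offset)
      where
      move : ∀ p₁ p₂ p₃ p₄ c x y z s →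
        p₁ * x + p₂ * y + p₃ * z + p₄ * c + s ≡ p₁ * x + p₂ * y + p₃ * z + (p₄ * c + s)
      move = solve-∀

    affineHyper-diagonal₁₂ : IsAffineCube (λ i k l → H i i k l) (p₁ + p₂) p₃ p₄
    affineHyper-diagonal₁₂ = mkAffine offset λ x y z →
      ≈-≡-trans (entries x x y z) (merge p₁ p₂ p₃ p₄ (toℤ x) (toℤ y) (toℤ z) offset)
      where
      merge : ∀ p₁ p₂ p₃ p₄ x y z s →
        p₁ * x + p₂ * x + p₃ * y + p₄ * z + s ≡ (p₁ + p₂) * x + p₃ * y + p₄ * z + s
      merge = solve-∀

    affineHyper-diagonal₁₃ : IsAffineCube (λ i j l → H i j i l) (p₁ + p₃) p₂ p₄
    affineHyper-diagonal₁₃ = mkAffine offset λ x y z →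
      ≈-≡-trans (entries x y x z) (merge p₁ p₂ p₃ p₄ (toℤ x) (toℤ y) (toℤ z) offset)
      where
      merge : ∀ p₁ p₂ p₃ p₄ x y z s →
        p₁ * x + p₂ * y + p₃ * x + p₄ * z + s ≡ (p₁ + p₃) * x + p₂ * y + p₄ * z + s
      merge = solve-∀

    affineHyper-diagonal₁₄ : IsAffineCube (λ i j k → H i j k i) (p₁ + p₄) p₂ p₃
    affineHyper-diagonal₁₄ = mkAffine offset λ x y z →
      ≈-≡-trans (entries x y z x) (merge p₁ p₂ p₃ p₄ (toℤ x) (toℤ y) (toℤ z) offset)
      where
      merge : ∀ p₁ p₂ p₃ p₄ x y z s →
        p₁ * x + p₂ * y + p₃ * z + p₄ * x + s ≡ (p₁ + p₄) * x + p₂ * y + p₃ * z + s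
      merge = solve-∀

    affineHyper-diagonal₂₃ : IsAffineCube (λ i j l → H i j j l) p₁ (p₂ + p₃) p₄
    affineHyper-diagonal₂₃ = mkAffine offset λ x y z →
      ≈-≡-trans (entries x y y z) (merge p₁ p₂ p₃ p₄ (toℤ x) (toℤ y) (toℤ z) offset)
      where
      merge : ∀ p₁ p₂ p₃ p₄ x y z s →
        p₁ * x + p₂ * y + p₃ * y + p₄ * z + s ≡ p₁ * x + (p₂ + p₃) * y + p₄ * z + s
      merge = solve-∀

    affineHyper-diagonal₂₄ : IsAffineCube (λ i j k → H i j k j) p₁ (p₂ + p₄) p₃
    affineHyper-diagonal₂₄ = mkAffine offset λ x y z →
      ≈-≡-trans (entries x y z y) (merge p₁ p₂ p₃ p₄ (toℤ x) (toℤ y) (toℤ z) offset)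
      where
      merge : ∀ p₁ p₂ p₃ p₄ x y z s →
        p₁ * x + p₂ * y + p₃ * z + p₄ * y + s ≡ p₁ * x + (p₂ + p₄) * y + p₃ * z + s
      merge = solve-∀

    affineHyper-diagonal₃₄ : IsAffineCube (λ i j k → H i j k k) p₁ p₂ (p₃ + p₄)
    affineHyper-diagonal₃₄ = mkAffine offset λ x y z →
      ≈-≡-trans (entries x y z z) (merge p₁ p₂ p₃ p₄ (toℤ x) (toℤ y) (toℤ z) offset)
      where
      merge : ∀ p₁ p₂ p₃ p₄ x y z s →
        p₁ * x + p₂ * y + p₃ * z + p₄ * z + s ≡ p₁ * x + p₂ * y + (p₃ + p₄) * z + s
      merge = solve-∀

    affineHyper-reflect₂ : IsAffineHyper (λ i j k l → H i (opposite j) k l) p₁ (- p₂) p₃ p₄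
    affineHyper-reflect₂ = mkAffine (offset + p₂ * (N - 1ℤ)) λ i j k l →
      ≈-≡-trans (entries i (opposite j) k l) (reflect (toℤ-opposite j))
      where
      reflect : ∀ {x y z w o} → o ≡ N - 1ℤ - y →
        p₁ * x + p₂ * o + p₃ * z + p₄ * w + offset ≡ p₁ * x + - p₂ * y + p₃ * z + p₄ * w + (offset + p₂ * (N - 1ℤ))
      reflect {x} {y} {z} {w} refl = ring p₁ p₂ p₃ p₄ x y z w offset N
        where
        ring : ∀ p₁ p₂ p₃ p₄ x y z w s N → p₁ * x + p₂ * (N - 1ℤ - y) + p₃ * z + p₄ * w + s
                                         ≡ p₁ * x + - p₂ * y + p₃ * z + p₄ * w + (s + p₂ * (N - 1ℤ))
        ring = solve-∀

    affineHyper-reflect₃ : IsAffineHyper (λ i j k l → H i j (opposite k) l) p₁ p₂ (- p₃) p₄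
    affineHyper-reflect₃ = mkAffine (offset + p₃ * (N - 1ℤ)) λ i j k l →
      ≈-≡-trans (entries i j (opposite k) l) (reflect (toℤ-opposite k))
      where
      reflect : ∀ {x y z w o} → o ≡ N - 1ℤ - z →
        p₁ * x + p₂ * y + p₃ * o + p₄ * w + offset ≡ p₁ * x + p₂ * y + - p₃ * z + p₄ * w + (offset + p₃ * (N - 1ℤ))
      reflect {x} {y} {z} {w} refl = ring p₁ p₂ p₃ p₄ x y z w offset N
        where
        ring : ∀ p₁ p₂ p₃ p₄ x y z w s N → p₁ * x + p₂ * y + p₃ * (N - 1ℤ - z) + p₄ * w + s
                                         ≡ p₁ * x + p₂ * y + - p₃ * z + p₄ * w + (s + p₃ * (N - 1ℤ))
        ring = solve-∀

    affineHyper-reflect₄ : IsAffineHyper (λ i j k l → H i j k (opposite l)) p₁ p₂ p₃ (- p₄)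
    affineHyper-reflect₄ = mkAffine (offset + p₄ * (N - 1ℤ)) λ i j k l →
      ≈-≡-trans (entries i j k (opposite l)) (reflect (toℤ-opposite l))
      where
      reflect : ∀ {x y z w o} → o ≡ N - 1ℤ - w →
        p₁ * x + p₂ * y + p₃ * z + p₄ * o + offset ≡ p₁ * x + p₂ * y + p₃ * z + - p₄ * w + (offset + p₄ * (N - 1ℤ))
      reflect {x} {y} {z} {w} refl = ring p₁ p₂ p₃ p₄ x y z w offset N
        where
        ring : ∀ p₁ p₂ p₃ p₄ x y z w s N → p₁ * x + p₂ * y + p₃ * z + p₄ * (N - 1ℤ - w) + s
                                         ≡ p₁ * x + p₂ * y + p₃ * z + - p₄ * w + (s + p₄ * (N - 1ℤ))
        ring = solve-∀

  module _ {k} (a : Fin k → ℤ) (P : LinExpr k → Set) (P⇒coprime : ∀ {e} → P e → Coprime (⟦ e ⟧ a) N) where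

    onSquareLines⇒pandiagonalSquare : ∀ {A u v} → OnSquareLines P u v →
      IsAffineSquare A (⟦ u ⟧ a) (⟦ v ⟧ a) → IsPandiagonalLatinSquare n A
    onSquareLines⇒pandiagonalSquare (Pu , Pv , Pu⊕v , Pu⊖v) =
      affine⇒pandiagonalSquare (P⇒coprime Pu) (P⇒coprime Pv) (P⇒coprime Pu⊕v) (P⇒coprime Pu⊖v)

    -- The antidiagonal constituents (x_b = opposite x_a) are diagonals of the array
    -- reflected in coordinate b, whose slope there is negated.
    onCubeLines⇒pandiagonalCube : ∀ {C u v w} → OnCubeLines P u v w →
      IsAffineCube C (⟦ u ⟧ a) (⟦ v ⟧ a) (⟦ w ⟧ a) → IsPandiagonalLatinCube n C
    onCubeLines⇒pandiagonalCube (ok₁ , ok₂ , ok₃ , ok₄ , ok₅ , ok₆ , ok₇ , ok₈ , ok₉) C-affine =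
        (λ c → onSquareLines⇒pandiagonalSquare ok₁ (affineCube-slice₁ C-affine c)
             , onSquareLines⇒pandiagonalSquare ok₂ (affineCube-slice₂ C-affine c)
             , onSquareLines⇒pandiagonalSquare ok₃ (affineCube-slice₃ C-affine c))
      , onSquareLines⇒pandiagonalSquare ok₄ (affineCube-diagonal₁₂ C-affine)
      , onSquareLines⇒pandiagonalSquare ok₅ (affineCube-diagonal₁₂ (affineCube-reflect₂ C-affine))
      , onSquareLines⇒pandiagonalSquare ok₆ (affineCube-diagonal₁₃ C-affine)
      , onSquareLines⇒pandiagonalSquare ok₇ (affineCube-diagonal₁₃ (affineCube-reflect₃ C-affine))
      , onSquareLines⇒pandiagonalSquare ok₈ (affineCube-diagonal₂₃ C-affine)
      , onSquareLines⇒pandiagonalSquare ok₉ (affineCube-diagonal₂₃ (affineCube-reflect₃ C-affine))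

    onHyperLines⇒4DPandiagonalCube : ∀ {H u v w t} → OnHyperLines P u v w t →
      IsAffineHyper H (⟦ u ⟧ a) (⟦ v ⟧ a) (⟦ w ⟧ a) (⟦ t ⟧ a) → Is4DPandiagonalLatinCube n H
    onHyperLines⇒4DPandiagonalCube
      (ok₁ , ok₂ , ok₃ , ok₄ , ok₅ , ok₆ , ok₇ , ok₈ , ok₉ , ok₁₀ , ok₁₁ , ok₁₂ , ok₁₃ , ok₁₄ , ok₁₅ , ok₁₆)
      H-affine =
        (λ c → onCubeLines⇒pandiagonalCube ok₁ (affineHyper-slice₁ H-affine c)
             , onCubeLines⇒pandiagonalCube ok₂ (affineHyper-slice₂ H-affine c)
             , onCubeLines⇒pandiagonalCube ok₃ (affineHyper-slice₃ H-affine c)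
             , onCubeLines⇒pandiagonalCube ok₄ (affineHyper-slice₄ H-affine c))
      , onCubeLines⇒pandiagonalCube ok₅  (affineHyper-diagonal₁₂ H-affine)
      , onCubeLines⇒pandiagonalCube ok₆  (affineHyper-diagonal₁₂ (affineHyper-reflect₂ H-affine))
      , onCubeLines⇒pandiagonalCube ok₇  (affineHyper-diagonal₁₃ H-affine)
      , onCubeLines⇒pandiagonalCube ok₈  (affineHyper-diagonal₁₃ (affineHyper-reflect₃ H-affine))
      , onCubeLines⇒pandiagonalCube ok₉  (affineHyper-diagonal₁₄ H-affine)
      , onCubeLines⇒pandiagonalCube ok₁₀ (affineHyper-diagonal₁₄ (affineHyper-reflect₄ H-affine))
      , onCubeLines⇒pandiagonalCube ok₁₁ (affineHyper-diagonal₂₃ H-affine)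
      , onCubeLines⇒pandiagonalCube ok₁₂ (affineHyper-diagonal₂₃ (affineHyper-reflect₃ H-affine))
      , onCubeLines⇒pandiagonalCube ok₁₃ (affineHyper-diagonal₂₄ H-affine)
      , onCubeLines⇒pandiagonalCube ok₁₄ (affineHyper-diagonal₂₄ (affineHyper-reflect₄ H-affine))
      , onCubeLines⇒pandiagonalCube ok₁₅ (affineHyper-diagonal₃₄ H-affine)
      , onCubeLines⇒pandiagonalCube ok₁₆ (affineHyper-diagonal₃₄ (affineHyper-reflect₄ H-affine))

  ≡±⇒coprime : ∀ {k} (a : Fin k → ℤ) (e f : LinExpr k) → coefficients e ≡± coefficients f →
               gcd (⟦ f ⟧ a) N ≡ + 1 → Coprime (⟦ e ⟧ a) N
  ≡±⇒coprime a e f (inj₁ e≡f) gcd≡1 = subst (λ z → Coprime z N) (begin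
    ⟦ f ⟧ a             ≡⟨ ⟦⟧≡coefficients-· f a ⟩
    coefficients f · a  ≡⟨ cong (_· a) e≡f ⟨
    coefficients e · a  ≡⟨ ⟦⟧≡coefficients-· e a ⟨
    ⟦ e ⟧ a             ∎) (gcd≡1⇒coprime (⟦ f ⟧ a) gcd≡1)
    where open ≡-Reasoning
  ≡±⇒coprime a e f (inj₂ e≡-f) gcd≡1 = subst (λ z → Coprime z N) (begin
    - ⟦ f ⟧ a                     ≡⟨ cong -_ (⟦⟧≡coefficients-· f a) ⟩
    - (coefficients f · a)        ≡⟨ map-neg-· (coefficients f) a ⟨
    map -_ (coefficients f) · a   ≡⟨ cong (_· a) e≡-f ⟨
    coefficients e · a            ≡⟨ ⟦⟧≡coefficients-· e a ⟨
    ⟦ e ⟧ a                       ∎) (coprime-neg (⟦ f ⟧ a) (gcd≡1⇒coprime (⟦ f ⟧ a) gcd≡1))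
    where open ≡-Reasoning

  module _ (a : Fin 4 → ℤ)
    (gcd-α       : ∀ m → gcd (⟦ var m ⟧ a) N ≡ + 1)
    (gcd-B-α     : ∀ m → gcd (⟦ total ⊖ var m ⟧ a) N ≡ + 1)
    (gcd-B       : gcd (⟦ total ⟧ a) N ≡ + 1)
    (gcd-B-2α    : ∀ m → gcd (⟦ total ⊖ + 2 ⊛ var m ⟧ a) N ≡ + 1)
    (gcd-α+α     : ∀ m m' → m' ≢ m → gcd (⟦ var m ⊕ var m' ⟧ a) N ≡ + 1)
    (gcd-α-α     : ∀ m m' → m' ≢ m → gcd (⟦ var m ⊖ var m' ⟧ a) N ≡ + 1)
    (gcd-B-α-2α  : ∀ m m' → m' ≢ m → gcd (⟦ total ⊖ var m' ⊖ + 2 ⊛ var m ⟧ a) N ≡ + 1)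
    (gcd-B-2α-2α : ∀ m m' → m' ≢ m → gcd (⟦ total ⊖ + 2 ⊛ var m' ⊖ + 2 ⊛ var m ⟧ a) N ≡ + 1)
    where

    covered⇒coprime : ∀ e → CoveredByHypotheses (coefficients e) → Coprime (⟦ e ⟧ a) N
    covered⇒coprime e (inj₁ (m , eq)) =
      ≡±⇒coprime a e (var m) eq (gcd-α m)
    covered⇒coprime e (inj₂ (inj₁ (m , eq))) =
      ≡±⇒coprime a e (total ⊖ var m) eq (gcd-B-α m)
    covered⇒coprime e (inj₂ (inj₂ (inj₁ eq))) =
      ≡±⇒coprime a e total eq gcd-B
    covered⇒coprime e (inj₂ (inj₂ (inj₂ (inj₁ (m , eq))))) =
      ≡±⇒coprime a e (total ⊖ + 2 ⊛ var m) eq (gcd-B-2α m)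
    covered⇒coprime e (inj₂ (inj₂ (inj₂ (inj₂ (inj₁ (m , m' , m'≢m , eq)))))) =
      ≡±⇒coprime a e (var m ⊕ var m') eq (gcd-α+α m m' m'≢m)
    covered⇒coprime e (inj₂ (inj₂ (inj₂ (inj₂ (inj₂ (inj₁ (m , m' , m'≢m , eq))))))) =
      ≡±⇒coprime a e (var m ⊖ var m') eq (gcd-α-α m m' m'≢m)
    covered⇒coprime e (inj₂ (inj₂ (inj₂ (inj₂ (inj₂ (inj₂ (inj₁ (m , m' , m'≢m , eq)))))))) =
      ≡±⇒coprime a e (total ⊖ var m' ⊖ + 2 ⊛ var m) eq (gcd-B-α-2α m m' m'≢m)
    covered⇒coprime e (inj₂ (inj₂ (inj₂ (inj₂ (inj₂ (inj₂ (inj₂ (m , m' , m'≢m , eq)))))))) =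
      ≡±⇒coprime a e (total ⊖ + 2 ⊛ var m' ⊖ + 2 ⊛ var m) eq (gcd-B-2α-2α m m' m'≢m)

    signCombination⇒coprime : ∀ {e} → IsSignCombination e → Coprime (⟦ e ⟧ a) N
    signCombination⇒coprime {e} = covered⇒coprime e ∘ signCombination⇒covered {e}

  linearArray-affine : ∀ α₁ α₂ α₃ α₄ →
    IsAffineHyper (linearArray n α₁ α₂ α₃ α₄) (+ α₁) (+ α₂) (+ α₃) (+ α₄)
  linearArray-affine α₁ α₂ α₃ α₄ = mkAffine 0ℤ λ i j k l →
    ≈-≡-trans (toℤ-mod _) (trans (pos-linear (toℕ i) (toℕ j) (toℕ k) (toℕ l)) (sym (+-identityʳ _)))
    where
    pos-linear : ∀ i j k l → + (α₁ ℕ.* i ℕ.+ α₂ ℕ.* j ℕ.+ α₃ ℕ.* k ℕ.+ α₄ ℕ.* l)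
                           ≡ + α₁ * + i + + α₂ * + j + + α₃ * + k + + α₄ * + l
    pos-linear i j k l =
      trans (pos-+ (α₁ ℕ.* i ℕ.+ α₂ ℕ.* j ℕ.+ α₃ ℕ.* k) (α₄ ℕ.* l)) (cong₂ _+_
        (trans (pos-+ (α₁ ℕ.* i ℕ.+ α₂ ℕ.* j) (α₃ ℕ.* k)) (cong₂ _+_
          (trans (pos-+ (α₁ ℕ.* i) (α₂ ℕ.* j)) (cong₂ _+_ (pos-* α₁ i) (pos-* α₂ j)))
          (pos-* α₃ k)))
        (pos-* α₄ l))

mainTheorem7 : (n : ℕ) .{{_ : NonZero n}} → n % 2 ≡ 1 →
    (α : Fin 4 → ℕ) → (∀ m → 1 ≤ α m) → (∀ m → α m < n) →
    let a : Fin 4 → ℤ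
        a m = + α m
        B : ℤ
        B = a zero + a (suc zero) + a (suc (suc zero)) + a (suc (suc (suc zero)))
        N : ℤ
        N = + n
    in (∀ m → gcd (a m) N ≡ + 1) →
       (∀ m → gcd (B - a m) N ≡ + 1) →
       gcd B N ≡ + 1 →
       (∀ m → gcd (B - + 2 * a m) N ≡ + 1) →
       (∀ m m' → m' ≢ m → gcd (a m + a m') N ≡ + 1) →
       (∀ m m' → m' ≢ m → gcd (a m - a m') N ≡ + 1) →
       (∀ m m' → m' ≢ m → gcd (B - a m' - + 2 * a m) N ≡ + 1) →
       (∀ m m' → m' ≢ m → gcd (B - + 2 * a m' - + 2 * a m) N ≡ + 1) →
       Is4DPandiagonalLatinCube n
         (linearArray n (α zero) (α (suc zero)) (α (suc (suc zero))) (α (suc (suc (suc zero)))))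
mainTheorem7 n _ α _ _ gcd-α gcd-B-α gcd-B gcd-B-2α gcd-α+α gcd-α-α gcd-B-α-2α gcd-B-2α-2α =
  onHyperLines⇒4DPandiagonalCube n a IsSignCombination
    (signCombination⇒coprime n a gcd-α gcd-B-α gcd-B gcd-B-2α gcd-α+α gcd-α-α gcd-B-α-2α gcd-B-2α-2α)
    everyLineSlopeIsSignCombination
    (linearArray-affine n (α zero) (α (suc zero)) (α (suc (suc zero))) (α (suc (suc (suc zero)))))
  where
  a : Fin 4 → ℤ
  a m = + α m
  everyLineSlopeIsSignCombination :
    OnHyperLines IsSignCombination (var zero) (var (suc zero)) (var (suc (suc zero))) (var (suc (suc (suc zero))))
  everyLineSlopeIsSignCombination = _
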